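{- Let $\mathbb{K}=(G,M,I)$ be a finite formal context with set of formal concepts $\mathfrak{B}(\mathbb{K})$, and let $S\subseteq \mathfrak{B}(\mathbb{K})$ be a set of formal concepts. Define $I_S := I\setminus \Big(\bigcup_{(A,B)\in S}A\times B \setminus \bigcup_{(A,B)\in\mathfrak{B}(\mathbb{K})\setminus S}A\times B \Big)$, $G_S := G\setminus \Big(\bigcup_{(A,B)\in S}A \setminus \bigcup_{(A,B)\in\mathfrak{B}(\mathbb{K})\setminus S} A\Big)$, $M_S := M\setminus \Big(\bigcup_{(A,B)\in S}B \setminus \bigcup_{(A,B)\in\mathfrak{B}(\mathbb{K})\setminus S}B \Big)$. Then $I_S= \bigcup_{(A,B)\in\mathfrak{B}(\mathbb{K})\setminus S} A\times B$, $G_S= \bigcup_{(A,B)\in\mathfrak{B}(\mathbb{K})\setminus S} A$ and $M_S= \bigcup_{(A,B)\in\mathfrak{B}(\mathbb{K})\setminus S} B$.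
   Context: A formal context $(G,M,I)$ consists of sets $G$ (objects), $M$ (attributes) and $I\subseteq G\times M$. For $A\subseteq G$, $A'=\{m\in M\mid (g,m)\in I\ \forall g\in A\}$, and for $B\subseteq M$, $B'=\{g\in G\mid (g,m)\in I\ \forall m\in B\}$. A formal concept is a pair $(A,B)$ with $A'=B$, $B'=A$; $\mathfrak{B}(\mathbb{K})$ denotes the set of all formal concepts. All sets are finite. -}

module Defs where

open import Data.Nat using (ℕ)
open import Data.Fin using (Fin)
open import Data.Fin.Subset using (Subset; _∈_)
open import Data.Bool using (Bool; T; not)
open import Data.Product using (_×_; _,_; proj₁; proj₂; Σ; ∃)
open import Function.Bundles using (_⇔_)
open import Relation.Nullary using (¬_)

-- A finite formal context: G = Fin n (objects), M = Fin k (attributes),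
-- incidence I given as a Boolean matrix; (g , m) ∈ I  iff  T (I g m).
Context : ℕ → ℕ → Set
Context n k = Fin n → Fin k → Bool

module _ {n k : ℕ} (I : Context n k) where

  _′ᴳ : Subset n → Fin k → Set
  (A ′ᴳ) m = ∀ g → g ∈ A → T (I g m)

  _′ᴹ : Subset k → Fin n → Set
  (B ′ᴹ) g = ∀ m → m ∈ B → T (I g m)

  IsConcept : Subset n × Subset k → Set
  IsConcept (A , B) = (∀ m → (m ∈ B) ⇔ (A ′ᴳ) m) × (∀ g → (g ∈ A) ⇔ (B ′ᴹ) g)

  -- A set S of pairs of subsets is represented by its (decidable)
  -- characteristic function; S ⊆ 𝔅(K):
  ConceptSet : Set
  ConceptSet = Σ (Subset n × Subset k → Bool)
                 (λ S → ∀ p → T (S p) → IsConcept p)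

  module _ (𝒮 : ConceptSet) where
    private S = proj₁ 𝒮

    InS : Subset n × Subset k → Set
    InS p = T (S p)

    InNotS : Subset n × Subset k → Set
    InNotS p = IsConcept p × ¬ T (S p)

    ∪S-I : Fin n → Fin k → Set
    ∪S-I g m = ∃ λ p → InS p × (g ∈ proj₁ p) × (m ∈ proj₂ p)

    ∪N-I : Fin n → Fin k → Set
    ∪N-I g m = ∃ λ p → InNotS p × (g ∈ proj₁ p) × (m ∈ proj₂ p)

    ∪S-G : Fin n → Set
    ∪S-G g = ∃ λ p → InS p × (g ∈ proj₁ p)

    ∪N-G : Fin n → Set
    ∪N-G g = ∃ λ p → InNotS p × (g ∈ proj₁ p)

    ∪S-M : Fin k → Set
    ∪S-M m = ∃ λ p → InS p × (m ∈ proj₂ p)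

    ∪N-M : Fin k → Set
    ∪N-M m = ∃ λ p → InNotS p × (m ∈ proj₂ p)

    I-S : Fin n → Fin k → Set
    I-S g m = T (I g m) × ¬ (∪S-I g m × ¬ ∪N-I g m)

    -- G_S := G ∖ (⋃_S A ∖ ⋃_{𝔅∖S} A)   (every g : Fin n is in G)
    G-S : Fin n → Set
    G-S g = ¬ (∪S-G g × ¬ ∪N-G g)

    -- M_S := M ∖ (⋃_S B ∖ ⋃_{𝔅∖S} B)   (every m : Fin k is in M)
    M-S : Fin k → Set
    M-S m = ¬ (∪S-M m × ¬ ∪N-M m)

{-# OPTIONS --safe #-}
-- Every object g lies in the extent of its object concept ({g}'', {g}'), every
-- attribute m in the intent of its attribute concept ({m}', {m}''), and every
-- incidence (g, m) ∈ I in A × B for the object concept (A, B) of g.  So each of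
-- G, M and I is covered by the concepts in S together with those outside S, and
-- removing from it what only S covers leaves exactly what 𝔅(K) ∖ S covers.
-- Constructively this needs "covered by 𝔅(K) ∖ S" to be decidable, which holds
-- because there are only finitely many pairs of subsets.
module Submission where

open import Defs
open import Level using (Level; 0ℓ)
open import Data.Nat using (ℕ)
open import Data.Fin using (Fin)
open import Data.Fin.Subset using (Subset; _∈_; ⁅_⁆)
open import Data.Fin.Subset.Properties using (_∈?_; anySubset?; x∈⁅x⁆; x∈⁅y⁆⇒x≡y)
open import Data.Fin.Properties using (all?)
open import Data.Vec using (tabulate)
open import Data.Vec.Properties using (lookup∘tabulate; []=⇒lookup; lookup⇒[]=)
open import Data.Bool using (T)
open import Data.Bool.Properties using (T-≡)
open import Data.Product using (_×_; _,_; proj₁; proj₂; ∃; swap)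
open import Data.Sum using (_⊎_; inj₁; inj₂)
open import Data.Empty using (⊥-elim)
open import Function using (_∘_; flip)
open import Function.Bundles using (_⇔_; mk⇔; Equivalence)
open import Relation.Binary.PropositionalEquality using (subst; sym; trans)
open import Relation.Nullary using (¬_; Dec; yes; no)
open import Relation.Nullary.Decidable using (T?; _×-dec_; _→-dec_; ¬?; map′; isYes; isYes≗does; toWitness; dec-true)
open import Relation.Unary using (Pred; Decidable)

open Equivalence

private
  variable
    ℓ : Level
    n k : ℕ

subset : {P : Pred (Fin n) ℓ} → Decidable P → Subset n
subset P? = tabulate (isYes ∘ P?)

∈-subset : {P : Pred (Fin n) ℓ} (P? : Decidable P) {i : Fin n} → i ∈ subset P? ⇔ P i
∈-subset P? {i} = mk⇔
  (λ i∈ → toWitness {a? = P? i} (from T-≡ (trans (sym (lookup∘tabulate _ i)) ([]=⇒lookup i∈))))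
  (λ p → lookup⇒[]= i _ (trans (lookup∘tabulate _ i) (trans (isYes≗does (P? i)) (dec-true (P? i) p))))

_⇔?_ : ∀ {a b} {A : Set a} {B : Set b} → Dec A → Dec B → Dec (A ⇔ B)
a? ⇔? b? = map′ (λ (f , g) → mk⇔ f g) (λ e → to e , from e) ((a? →-dec b?) ×-dec (b? →-dec a?))

anyPair? : {P : Pred (Subset n × Subset k) ℓ} → Decidable P → Dec (∃ P)
anyPair? P? = map′ (λ (A , B , p) → (A , B) , p) (λ ((A , B) , p) → A , B , p)
  (anySubset? (λ A → anySubset? (λ B → P? (A , B))))

module _ (I : Context n k) where

  ′ᴳ? : (A : Subset n) → Decidable (_′ᴳ I A)
  ′ᴳ? A m = all? (λ g → (g ∈? A) →-dec T? (I g m))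

  ′ᴹ? : (B : Subset k) → Decidable (_′ᴹ I B)
  ′ᴹ? B g = all? (λ m → (m ∈? B) →-dec T? (I g m))

  isConcept? : Decidable (IsConcept I)
  isConcept? (A , B) = all? (λ m → (m ∈? B) ⇔? ′ᴳ? A m)
                ×-dec all? (λ g → (g ∈? A) ⇔? ′ᴹ? B g)

  concept⇒incident : ∀ {A B g m} → IsConcept I (A , B) → g ∈ A → m ∈ B → T (I g m)
  concept⇒incident (intent , _) g∈A m∈B = to (intent _) m∈B _ g∈A

  derive : Subset n → Subset k
  derive A = subset (′ᴳ? A)

  closure : Subset n → Subset n
  closure A = subset (′ᴹ? (derive A))

  ⊆-closure : ∀ A {g} → g ∈ A → g ∈ closure A
  ⊆-closure A g∈A = from (∈-subset (′ᴹ? _)) (λ m m∈A′ → to (∈-subset (′ᴳ? A)) m∈A′ _ g∈A)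

  closure-isConcept : ∀ A → IsConcept I (closure A , derive A)
  closure-isConcept A =
      (λ m → mk⇔ (λ m∈A′ g g∈A′′ → to (∈-subset (′ᴹ? _)) g∈A′′ m m∈A′)
                 (λ m∈A′′′ → from (∈-subset (′ᴳ? A)) (λ g → m∈A′′′ g ∘ ⊆-closure A)))
    , (λ g → ∈-subset (′ᴹ? _))

  objectConcept : Fin n → Subset n × Subset k
  objectConcept g = closure ⁅ g ⁆ , derive ⁅ g ⁆

  objectConcept-isConcept : ∀ g → IsConcept I (objectConcept g)
  objectConcept-isConcept g = closure-isConcept ⁅ g ⁆

  ∈-objectExtent : ∀ g → g ∈ proj₁ (objectConcept g)
  ∈-objectExtent g = ⊆-closure ⁅ g ⁆ (x∈⁅x⁆ g)

  incident⇒∈-objectIntent : ∀ {g m} → T (I g m) → m ∈ proj₂ (objectConcept g)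
  incident⇒∈-objectIntent {g} t =
    from (∈-subset (′ᴳ? _)) (λ g′ g′∈⁅g⁆ → subst (λ h → T (I h _)) (sym (x∈⁅y⁆⇒x≡y g g′∈⁅g⁆)) t)

-- IsConcept (flip I) (B , A) is IsConcept I (A , B) with its two components swapped.
module _ (I : Context n k) where

  attributeConcept : Fin k → Subset n × Subset k
  attributeConcept m = swap (objectConcept (flip I) m)

  attributeConcept-isConcept : ∀ m → IsConcept I (attributeConcept m)
  attributeConcept-isConcept m = swap (objectConcept-isConcept (flip I) m)

  ∈-attributeIntent : ∀ m → m ∈ proj₂ (attributeConcept m)
  ∈-attributeIntent = ∈-objectExtent (flip I)

module _ (I : Context n k) (𝒮 : ConceptSet I) where

  ∪S : Pred (Subset n × Subset k) 0ℓ → Set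
  ∪S Q = ∃ λ p → InS I 𝒮 p × Q p

  ∪N : Pred (Subset n × Subset k) 0ℓ → Set
  ∪N Q = ∃ λ p → InNotS I 𝒮 p × Q p

  ∪N? : {Q : Pred (Subset n × Subset k) 0ℓ} → Decidable Q → Dec (∪N Q)
  ∪N? Q? = anyPair? (λ p → (isConcept? I p ×-dec ¬? (T? (proj₁ 𝒮 p))) ×-dec Q? p)

  concept-covered : ∀ {Q p} → IsConcept I p → Q p → ∪S Q ⊎ ∪N Q
  concept-covered {p = p} c q with T? (proj₁ 𝒮 p)
  ... | yes s = inj₁ (p , s , q)
  ... | no ¬s = inj₂ (p , (c , ¬s) , q)

  ∖-covered : ∀ {Q p} → Decidable Q → IsConcept I p → Q p → (¬ (∪S Q × ¬ ∪N Q)) ⇔ ∪N Q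
  ∖-covered {Q} Q? c q = mk⇔ only-N (λ n (_ , ¬n) → ¬n n)
    where
    only-N : ¬ (∪S Q × ¬ ∪N Q) → ∪N Q
    only-N h with ∪N? Q? | concept-covered c q
    ... | yes n | _      = n
    ... | no ¬n | inj₁ s = ⊥-elim (h (s , ¬n))
    ... | no _  | inj₂ n = n

lemma1 : {n k : ℕ} (I : Context n k) (S : ConceptSet I) →
    (∀ g m → I-S I S g m ⇔ ∪N-I I S g m)
    × (∀ g → G-S I S g ⇔ ∪N-G I S g)
    × (∀ m → M-S I S m ⇔ ∪N-M I S m)
lemma1 I S =
    (λ g m → let covered t = ∖-covered I S (λ p → (g ∈? proj₁ p) ×-dec (m ∈? proj₂ p))
                               (objectConcept-isConcept I g)
                               (∈-objectExtent I g , incident⇒∈-objectIntent I t)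
             in mk⇔ (λ (t , h) → to (covered t) h)
                    (λ N@(_ , (c , _) , g∈A , m∈B) →
                       let t = concept⇒incident I c g∈A m∈B in t , from (covered t) N))
  , (λ g → ∖-covered I S (λ p → g ∈? proj₁ p) (objectConcept-isConcept I g) (∈-objectExtent I g))
  , (λ m → ∖-covered I S (λ p → m ∈? proj₂ p) (attributeConcept-isConcept I m) (∈-attributeIntent I m))
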